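{- Let $\mathcal{A}$ be a computable partial injection structure with unbounded cycle character, or with unbounded finite chain character, or with an infinite orbit, and let $C$ be a cohesive set. Then $\prod_C\mathcal{A}$ has infinitely many $Z$-chains. Consequently, if in addition $\mathcal{A}$ has only finitely many $Z$-chains, then $\mathcal{A}\not\cong\prod_C\mathcal{A}$.
   Context: A partial injection structure $(A,f)$ is a set $A$ with a partial function $f:A\to A$ that is one-to-one on its domain; it is viewed as the relational structure $(A,G_f)$ with $G_f=\{(x,y):x\in\mathrm{dom}(f),f(x)=y\}$, and it is computable if $A\subseteq\omega$ is computable, $f$ is partial computable and $G_f$ is computable. The orbit of $a$ is $\{b:\exists n\in\omega\,(f^n(a)\downarrow=b\vee f^n(b)\downarrow=a)\}$. A $Z$-chain is an infinite orbit all of whose elements lie in both $\mathrm{dom}(f)$ and $\mathrm{ran}(f)$. A $k$-cycle is an orbit $\{x_1,\dots,x_k\}$ of distinct elements with $f(x_i)=x_{i+1}$ ($i<k$), $f(x_k)=x_1$; a $k$-chain is an orbit $\{x_1,\dots,x_k\}$ of distinct elements with $x_1\notin\mathrm{ran}(f)$, $x_{i+1}=f(x_i)$, $x_k\notin\mathrm{dom}(f)$. The cycle character (resp. finite chain character) is the set of $\langle k,n\rangle$, $k,n\ge1$, such that $\mathcal{A}$ has at least $n$ $k$-cycles (resp. $k$-chains); it is unbounded if there is no upper bound on such $k$. A set $C\subseteq\omega$ is cohesive if it is infinite and for every c.e. set $W$, one of $W\cap C$, $\overline{W}\cap C$ is finite; $X\subseteq^*Y$ means $X\setminus Y$ is finite.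 The cohesive power $\prod_C\mathcal{A}$ has as domain the partial computable functions $\psi:\omega\to A$ with $C\subseteq^*\mathrm{dom}(\psi)$, modulo $\psi_1=_C\psi_2$ iff $C\subseteq^*\{i:\psi_1(i)\downarrow=\psi_2(i)\downarrow\}$, with $G([\psi],[\varphi])$ iff $C\subseteq^*\{i:(\psi(i),\varphi(i))\in G_f\}$; it is again a partial injection structure, whose orbits are defined likewise. -}

module Defs where

open import Data.Nat using (ℕ; zero; suc; _<_; _≤_)
open import Data.Fin using (Fin; inject₁; fromℕ) renaming (zero to fzero; suc to fsuc)
open import Data.Vec using (Vec; []; _∷_; lookup)
open import Data.Product using (Σ; ∃; _×_; _,_; proj₁)
open import Data.Sum using (_⊎_)
open import Data.Empty using (⊥)
open import Relation.Nullary using (¬_)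
open import Relation.Binary.PropositionalEquality using (_≡_)

-- A model of computation: (codes of) partial recursive functions
-- (Kleene's μ-recursive functions) with a big-step evaluation relation.

data PR : ℕ → Set where
  zeroᶠ : ∀ {n} → PR n
  succᶠ : PR 1
  proj  : ∀ {n} → Fin n → PR n
  comp  : ∀ {m n} → PR m → (Fin m → PR n) → PR n
  prec  : ∀ {n} → PR n → PR (suc (suc n)) → PR (suc n)
  mu    : ∀ {n} → PR (suc n) → PR n

data Eval : ∀ {n} → PR n → Vec ℕ n → ℕ → Set where
  ev-zero : ∀ {n} {xs : Vec ℕ n} → Eval zeroᶠ xs 0
  ev-succ : ∀ {x} → Eval succᶠ (x ∷ []) (suc x)
  ev-proj : ∀ {n} {i : Fin n} {xs} → Eval (proj i) xs (lookup xs i)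
  ev-comp : ∀ {m n} {f : PR m} {gs : Fin m → PR n} {xs y} (ys : Vec ℕ m) →
            (∀ i → Eval (gs i) xs (lookup ys i)) → Eval f ys y →
            Eval (comp f gs) xs y
  ev-prec0 : ∀ {n} {g : PR n} {h : PR (suc (suc n))} {xs y} →
             Eval g xs y → Eval (prec g h) (0 ∷ xs) y
  ev-precS : ∀ {n} {g : PR n} {h : PR (suc (suc n))} {xs k r y} →
             Eval (prec g h) (k ∷ xs) r → Eval h (k ∷ r ∷ xs) y →
             Eval (prec g h) (suc k ∷ xs) y
  ev-mu : ∀ {n} {f : PR (suc n)} {xs : Vec ℕ n} {y} →
          Eval f (y ∷ xs) 0 →
          (∀ k → k < y → ∃ λ r → Eval f (k ∷ xs) (suc r)) →
          Eval (mu f) xs y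

_↓_ : PR 1 → ℕ → Set
e ↓ i = ∃ λ v → Eval e (i ∷ []) v

FiniteSet : (ℕ → Set) → Set
FiniteSet S = ∃ λ b → ∀ x → S x → x < b

InfiniteSet : (ℕ → Set) → Set
InfiniteSet S = ∀ b → ∃ λ x → b ≤ x × S x

_⊆*_ : (ℕ → Set) → (ℕ → Set) → Set
X ⊆* Y = FiniteSet (λ x → X x × ¬ Y x)

W : PR 1 → ℕ → Set
W e x = e ↓ x

Cohesive : (ℕ → Set) → Set
Cohesive C = InfiniteSet C ×
  (∀ (e : PR 1) → FiniteSet (λ x → W e x × C x) ⊎ FiniteSet (λ x → ¬ W e x × C x))

-- Relational structures (A, G) up to an equality relation ≈
-- (needed because the cohesive power is a quotient).

record Str : Set₁ where
  field
    Carrier : Set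
    _≈_     : Carrier → Carrier → Set
    G       : Carrier → Carrier → Set   -- the graph G_f of the partial injection

module _ (S : Str) where
  open Str S

  Iter : ℕ → Carrier → Carrier → Set
  Iter zero    a b = a ≈ b
  Iter (suc n) a b = ∃ λ c → G a c × Iter n c b

  InOrbit : Carrier → Carrier → Set
  InOrbit a b = ∃ λ n → Iter n a b ⊎ Iter n b a

  InDom : Carrier → Set
  InDom x = ∃ λ y → G x y

  InRan : Carrier → Set
  InRan x = ∃ λ y → G y x

  InfinitelyMany : (Carrier → Set) → Set
  InfinitelyMany P = ∀ n → ∃ λ (v : Fin n → Carrier) →
    (∀ i → P (v i)) × (∀ i j → v i ≈ v j → i ≡ j)

  InfiniteOrbit : Carrier → Set
  InfiniteOrbit a = InfinitelyMany (InOrbit a)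

  IsZChain : Carrier → Set
  IsZChain a = InfiniteOrbit a × (∀ b → InOrbit a b → InDom b × InRan b)

  InfinitelyManyZChains : Set
  InfinitelyManyZChains = ∀ n → ∃ λ (v : Fin n → Carrier) →
    (∀ i → IsZChain (v i)) × (∀ i j → InOrbit (v i) (v j) → i ≡ j)

  FinitelyManyZChains : Set
  FinitelyManyZChains = ∃ λ n → ∃ λ (v : Fin n → Carrier) →
    ∀ a → IsZChain a → ∃ λ i → InOrbit (v i) a

  IsCycle : (m : ℕ) → (Fin (suc m) → Carrier) → Set
  IsCycle m v = (∀ i j → v i ≈ v j → i ≡ j)
    × (∀ (i : Fin m) → G (v (inject₁ i)) (v (fsuc i)))
    × G (v (fromℕ m)) (v fzero)

  IsFiniteChain : (m : ℕ) → (Fin (suc m) → Carrier) → Set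
  IsFiniteChain m v = (∀ i j → v i ≈ v j → i ≡ j)
    × (∀ (i : Fin m) → G (v (inject₁ i)) (v (fsuc i)))
    × ¬ InRan (v fzero) × ¬ InDom (v (fromℕ m))

  -- ⟨k,1⟩ in the cycle character for arbitrarily large k
  UnboundedCycleCharacter : Set
  UnboundedCycleCharacter = ∀ b → ∃ λ m → b ≤ m × ∃ λ v → IsCycle m v

  UnboundedFiniteChainCharacter : Set
  UnboundedFiniteChainCharacter = ∀ b → ∃ λ m → b ≤ m × ∃ λ v → IsFiniteChain m v

  HasInfiniteOrbit : Set
  HasInfiniteOrbit = ∃ λ a → InfiniteOrbit a

record _≅_ (S T : Str) : Set where
  module S = Str S
  module T = Str T
  field
    h        : S.Carrier → T.Carrier
    resp     : ∀ x y → x S.≈ y → h x T.≈ h y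
    inj      : ∀ x y → h x T.≈ h y → x S.≈ y
    surj     : ∀ z → ∃ λ x → h x T.≈ z
    pres     : ∀ x y → S.G x y → T.G (h x) (h y)
    refl-G   : ∀ x y → T.G (h x) (h y) → S.G x y

record CompPIS : Set where
  field
    χA : PR 1
    fᶜ : PR 1
    χG : PR 2

  InA : ℕ → Set
  InA x = Eval χA (x ∷ []) 1

  F : ℕ → ℕ → Set
  F x y = Eval fᶜ (x ∷ []) y

  field
    χA-total : ∀ x → Eval χA (x ∷ []) 0 ⊎ Eval χA (x ∷ []) 1
    χG-total : ∀ x y → Eval χG (x ∷ y ∷ []) 0 ⊎ Eval χG (x ∷ y ∷ []) 1
    χG-spec₁ : ∀ x y → Eval χG (x ∷ y ∷ []) 1 → F x y
    χG-spec₂ : ∀ x y → F x y → Eval χG (x ∷ y ∷ []) 1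
    f-into   : ∀ x y → F x y → InA x × InA y
    f-inj    : ∀ x x' y → F x y → F x' y → x ≡ x'

module _ (𝒜 : CompPIS) where
  open CompPIS 𝒜

  structure : Str
  structure = record
    { Carrier = Σ ℕ InA
    ; _≈_     = λ a b → proj₁ a ≡ proj₁ b
    ; G       = λ a b → F (proj₁ a) (proj₁ b)
    }

  record PowElt (C : ℕ → Set) : Set where
    field
      code   : PR 1
      into-A : ∀ i v → Eval code (i ∷ []) v → InA v
      dom-C  : C ⊆* (λ i → code ↓ i)

  CohesivePower : (C : ℕ → Set) → Str
  CohesivePower C = record
    { Carrier = PowElt C
    ; _≈_ = λ ψ φ → C ⊆* (λ i → ∃ λ v →
              Eval (PowElt.code ψ) (i ∷ []) v × Eval (PowElt.code φ) (i ∷ []) v)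
    ; G   = λ ψ φ → C ⊆* (λ i → ∃ λ u → ∃ λ v →
              Eval (PowElt.code ψ) (i ∷ []) u × Eval (PowElt.code φ) (i ∷ []) v × F u v)
    }

-- Each hypothesis gives, for every L, a path x, f x, …, fᴸ x of distinct points of 𝒜: an infinite
-- orbit contains no cycle, and of 1 + 2L of its points one lies at distance at least L from the base.
-- Fix n. As the graph of f is decidable, a computable search finds, uniformly in i, such a path of
-- length (1+i)(1+n) together with a bound on its points; let ψⱼ(i), j < n, be its point at position
-- (1+i)(1+j). For i ≥ r, fʳ ∘ ψⱼ is defined at i and sits at position (1+i)(1+j) + r, strictly inside
-- the path. Hence in the cohesive power the iterates fʳ[ψⱼ] are pairwise distinct and every point of
-- their orbit has an f-image and an f-preimage, so each [ψⱼ] spans a Z-chain; and the orbits of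
-- [ψⱼ] and [ψₖ] differ, since (1+i)(1+j) + m ≠ (1+i)(1+k) once i ≥ m. An isomorphism carries Z-chains to Z-chains and orbits to orbits, so it cannot match finitely
-- many Z-chains of 𝒜 with infinitely many of the cohesive power.

module Submission where

open import Defs
open import Data.Nat using (ℕ; zero; suc; _+_; _*_; _∸_; _≤_; _<_; z≤n; s≤s; pred; _⊔_; _≟_; _<?_; _≤?_)
open import Data.Nat.Properties
open import Data.Fin using (Fin; toℕ; fromℕ<; inject₁; join; splitAt) renaming (zero to fzero; suc to fsuc)
open import Data.Fin.Properties using (toℕ-injective; toℕ<n; toℕ-fromℕ<; toℕ-inject₁; fromℕ<-injective; splitAt-join; any?; pigeonhole)
open import Data.Vec using (Vec; []; _∷_; lookup; tabulate)
open import Data.Vec.Properties using (lookup∘tabulate; tabulate∘lookup; tabulate-cong)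
open import Data.Product using (∃; _×_; _,_; proj₁; proj₂)
open import Data.Sum using (_⊎_; inj₁; inj₂; [_,_]′)
open import Data.Sum.Properties using (inj₁-injective; inj₂-injective)
open import Data.Empty using (⊥; ⊥-elim)
open import Data.Unit using (⊤; tt)
open import Relation.Nullary using (¬_; yes; no)
open import Relation.Binary using (tri<; tri≈; tri>)
open import Relation.Binary.PropositionalEquality hiding (resp)

lookup-extensional : ∀ {m} (ys ys′ : Vec ℕ m) → (∀ i → lookup ys i ≡ lookup ys′ i) → ys ≡ ys′
lookup-extensional ys ys′ eq = trans (sym (tabulate∘lookup ys)) (trans (tabulate-cong eq) (tabulate∘lookup ys′))

Eval-deterministic : ∀ {n} {e : PR n} {xs y y′} → Eval e xs y → Eval e xs y′ → y ≡ y′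
Eval-deterministic ev-zero ev-zero = refl
Eval-deterministic ev-succ ev-succ = refl
Eval-deterministic ev-proj ev-proj = refl
Eval-deterministic (ev-comp ys p q) (ev-comp ys′ p′ q′)
  with lookup-extensional ys ys′ (λ i → Eval-deterministic (p i) (p′ i))
... | refl = Eval-deterministic q q′
Eval-deterministic (ev-prec0 p) (ev-prec0 p′) = Eval-deterministic p p′
Eval-deterministic (ev-precS p q) (ev-precS p′ q′) with Eval-deterministic p p′
... | refl = Eval-deterministic q q′
Eval-deterministic {y = y} {y′} (ev-mu p below) (ev-mu p′ below′) with <-cmp y y′
... | tri< y<y′ _ _ = ⊥-elim (0≢1+n (Eval-deterministic p (proj₂ (below′ y y<y′))))
... | tri≈ _ y≡y′ _ = y≡y′
... | tri> _ _ y′<y = ⊥-elim (0≢1+n (Eval-deterministic p′ (proj₂ (below y′ y′<y))))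

-- Codes with a total semantics ⟦_⟧: the μ-free codes, together with any code e
-- packaged with a total function s that e provably computes.
data Total : ℕ → Set where
  zeroᵗ  : ∀ {n} → Total n
  sucᵗ   : Total 1
  projᵗ  : ∀ {n} → Fin n → Total n
  compᵗ  : ∀ {m n} → Total m → (Fin m → Total n) → Total n
  precᵗ  : ∀ {n} → Total n → Total (suc (suc n)) → Total (suc n)
  embedᵗ : ∀ {n} (e : PR n) (s : Vec ℕ n → ℕ) → (∀ xs → Eval e xs (s xs)) → Total n

⌜_⌝ : ∀ {n} → Total n → PR n
⌜ zeroᵗ ⌝        = zeroᶠ
⌜ sucᵗ ⌝         = succᶠ
⌜ projᵗ i ⌝      = proj i
⌜ compᵗ f gs ⌝   = comp ⌜ f ⌝ (λ i → ⌜ gs i ⌝)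
⌜ precᵗ g h ⌝    = prec ⌜ g ⌝ ⌜ h ⌝
⌜ embedᵗ e _ _ ⌝ = e

⟦_⟧ : ∀ {n} → Total n → Vec ℕ n → ℕ
⟦ zeroᵗ ⟧ _                     = 0
⟦ sucᵗ ⟧ (x ∷ [])               = suc x
⟦ projᵗ i ⟧ xs                  = lookup xs i
⟦ compᵗ f gs ⟧ xs               = ⟦ f ⟧ (tabulate (λ i → ⟦ gs i ⟧ xs))
⟦ precᵗ g h ⟧ (zero ∷ xs)       = ⟦ g ⟧ xs
⟦ precᵗ g h ⟧ (suc k ∷ xs)      = ⟦ h ⟧ (k ∷ ⟦ precᵗ g h ⟧ (k ∷ xs) ∷ xs)
⟦ embedᵗ _ s _ ⟧ xs             = s xs

Eval-⟦⟧ : ∀ {n} (t : Total n) xs → Eval ⌜ t ⌝ xs (⟦ t ⟧ xs)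
Eval-⟦⟧ zeroᵗ xs = ev-zero
Eval-⟦⟧ sucᵗ (x ∷ []) = ev-succ
Eval-⟦⟧ (projᵗ i) xs = ev-proj
Eval-⟦⟧ (compᵗ f gs) xs = ev-comp (tabulate (λ i → ⟦ gs i ⟧ xs))
  (λ i → subst (Eval ⌜ gs i ⌝ xs) (sym (lookup∘tabulate (λ i → ⟦ gs i ⟧ xs) i)) (Eval-⟦⟧ (gs i) xs))
  (Eval-⟦⟧ f _)
Eval-⟦⟧ (precᵗ g h) (zero ∷ xs) = ev-prec0 (Eval-⟦⟧ g xs)
Eval-⟦⟧ (precᵗ g h) (suc k ∷ xs) = ev-precS (Eval-⟦⟧ (precᵗ g h) (k ∷ xs)) (Eval-⟦⟧ h _)
Eval-⟦⟧ (embedᵗ e s evaluates) xs = evaluates xs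

Eval⇒≡⟦⟧ : ∀ {n} (t : Total n) {xs v} → Eval ⌜ t ⌝ xs v → v ≡ ⟦ t ⟧ xs
Eval⇒≡⟦⟧ t e = Eval-deterministic e (Eval-⟦⟧ t _)

-- Repackaging a code with the function it is proved to compute makes its
-- semantics hold definitionally in every composite code built from it.
realise : ∀ {n} (t : Total n) (s : Vec ℕ n → ℕ) → (∀ xs → ⟦ t ⟧ xs ≡ s xs) → Total n
realise t s ⟦t⟧≗s = embedᵗ ⌜ t ⌝ s (λ xs → subst (Eval ⌜ t ⌝ xs) (⟦t⟧≗s xs) (Eval-⟦⟧ t xs))

infixl 30 _⟨_⟩
_⟨_⟩ : ∀ {m n} → Total m → Vec (Total n) m → Total n
f ⟨ gs ⟩ = compᵗ f (lookup gs)

π₀ : ∀ {n} → Total (suc n)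
π₀ = projᵗ fzero

π₁ : ∀ {n} → Total (suc (suc n))
π₁ = projᵗ (fsuc fzero)

π₂ : ∀ {n} → Total (suc (suc (suc n)))
π₂ = projᵗ (fsuc (fsuc fzero))

π₃ : ∀ {n} → Total (suc (suc (suc (suc n))))
π₃ = projᵗ (fsuc (fsuc (fsuc fzero)))

isZero : ℕ → ℕ
isZero zero    = 1
isZero (suc _) = 0

isZeroᵗ : Total 1
isZeroᵗ = realise (precᵗ (sucᵗ ⟨ zeroᵗ ∷ [] ⟩) zeroᵗ) (λ { (x ∷ []) → isZero x }) λ
  { (zero ∷ []) → refl ; (suc _ ∷ []) → refl }

constᵗ : ∀ {n} → ℕ → Total n
constᵗ c = realise (iterate c) (λ _ → c) (⟦iterate⟧ c)
  where
  iterate : ∀ {n} → ℕ → Total n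
  iterate zero    = zeroᵗ
  iterate (suc c) = sucᵗ ⟨ iterate c ∷ [] ⟩
  ⟦iterate⟧ : ∀ {n} c (xs : Vec ℕ n) → ⟦ iterate c ⟧ xs ≡ c
  ⟦iterate⟧ zero    xs = refl
  ⟦iterate⟧ (suc c) xs = cong suc (⟦iterate⟧ c xs)

+ᵗ : Total 2
+ᵗ = realise add (λ { (x ∷ y ∷ []) → x + y }) λ { (x ∷ y ∷ []) → ⟦add⟧ x y }
  where
  add : Total 2
  add = precᵗ π₀ (sucᵗ ⟨ π₁ ∷ [] ⟩)
  ⟦add⟧ : ∀ x y → ⟦ add ⟧ (x ∷ y ∷ []) ≡ x + y
  ⟦add⟧ zero    y = refl
  ⟦add⟧ (suc x) y = cong suc (⟦add⟧ x y)

*ᵗ : Total 2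
*ᵗ = realise mul (λ { (x ∷ y ∷ []) → x * y }) λ { (x ∷ y ∷ []) → ⟦mul⟧ x y }
  where
  mul : Total 2
  mul = precᵗ zeroᵗ (+ᵗ ⟨ π₂ ∷ π₁ ∷ [] ⟩)
  ⟦mul⟧ : ∀ x y → ⟦ mul ⟧ (x ∷ y ∷ []) ≡ x * y
  ⟦mul⟧ zero    y = refl
  ⟦mul⟧ (suc x) y = cong (y +_) (⟦mul⟧ x y)

∸ᵗ : Total 2
∸ᵗ = realise (monus ⟨ π₁ ∷ π₀ ∷ [] ⟩) (λ { (x ∷ y ∷ []) → x ∸ y }) λ { (x ∷ y ∷ []) → ⟦monus⟧ y x }
  where
  predᵗ : Total 1
  predᵗ = realise (precᵗ zeroᵗ π₀) (λ { (x ∷ []) → pred x }) λ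
    { (zero ∷ []) → refl ; (suc _ ∷ []) → refl }
  monus : Total 2
  monus = precᵗ π₀ (predᵗ ⟨ π₁ ∷ [] ⟩)
  ⟦monus⟧ : ∀ y x → ⟦ monus ⟧ (y ∷ x ∷ []) ≡ x ∸ y
  ⟦monus⟧ zero    x = refl
  ⟦monus⟧ (suc y) x = trans (cong pred (⟦monus⟧ y x)) (pred[m∸n]≡m∸[1+n] x y)

≢0⇒isZero≡0 : ∀ {x} → x ≢ 0 → isZero x ≡ 0
≢0⇒isZero≡0 {zero}  x≢0 = ⊥-elim (x≢0 refl)
≢0⇒isZero≡0 {suc x} _   = refl

isZero≡0⇒≢0 : ∀ {x} → isZero x ≡ 0 → x ≢ 0
isZero≡0⇒≢0 () refl

-- μ< P c is the least y < c with P y ≡ 0, or c if there is none.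
μ< : (ℕ → ℕ) → ℕ → ℕ
μ< P zero    = 0
μ< P (suc c) = μ< P c + isZero ((c ∸ μ< P c) + isZero (P c))

module _ (P : ℕ → ℕ) where

  private
    μ<-stays : ∀ {c} → μ< P c < c → μ< P (suc c) ≡ μ< P c
    μ<-stays {c} lt = trans (cong (λ d → μ< P c + isZero (d + isZero (P c))) (+-∸-assoc 1 lt))
                            (+-identityʳ (μ< P c))

    μ<-hit : ∀ {c} → μ< P c ≡ c → P c ≡ 0 → μ< P (suc c) ≡ c
    μ<-hit {c} eq hit = begin
      μ< P c + isZero ((c ∸ μ< P c) + isZero (P c))  ≡⟨ cong₂ (λ a p → a + isZero ((c ∸ a) + isZero p)) eq hit ⟩
      c + isZero ((c ∸ c) + 1)                      ≡⟨ cong (λ d → c + isZero (d + 1)) (n∸n≡0 c) ⟩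
      c + 0                                         ≡⟨ +-identityʳ c ⟩
      c                                             ∎
      where open ≡-Reasoning

    μ<-miss : ∀ {c} → μ< P c ≡ c → P c ≢ 0 → μ< P (suc c) ≡ suc c
    μ<-miss {c} eq miss = begin
      μ< P c + isZero ((c ∸ μ< P c) + isZero (P c))  ≡⟨ cong₂ (λ a p → a + isZero ((c ∸ a) + p)) eq (≢0⇒isZero≡0 miss) ⟩
      c + isZero ((c ∸ c) + 0)                      ≡⟨ cong (λ d → c + isZero (d + 0)) (n∸n≡0 c) ⟩
      c + 1                                         ≡⟨ +-comm c 1 ⟩
      suc c                                         ∎
      where open ≡-Reasoning

    Found : ℕ → Set
    Found c = μ< P c < c × P (μ< P c) ≡ 0

    μ<-spec : ∀ c → (Found c ⊎ μ< P c ≡ c) × (∀ y → y < μ< P c → P y ≢ 0)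
    μ<-spec zero = inj₂ refl , λ _ ()
    μ<-spec (suc c) with μ<-spec c
    ... | inj₁ (lt , hit) , minimal =
      inj₁ (subst (λ a → a < suc c × P a ≡ 0) (sym (μ<-stays lt)) (m<n⇒m<1+n lt , hit)) ,
      subst (λ a → ∀ y → y < a → P y ≢ 0) (sym (μ<-stays lt)) minimal
    ... | inj₂ eq , minimal with P c ≟ 0
    ...   | yes hit =
      inj₁ (subst (λ a → a < suc c × P a ≡ 0) (sym (μ<-hit eq hit)) (n<1+n c , hit)) ,
      subst (λ a → ∀ y → y < a → P y ≢ 0) (sym (μ<-hit eq hit)) (subst (λ a → ∀ y → y < a → P y ≢ 0) eq minimal)
    ...   | no miss = inj₂ (μ<-miss eq miss) , λ y y<a → extend y (subst (y <_) (μ<-miss eq miss) y<a)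
      where
      extend : ∀ y → y < suc c → P y ≢ 0
      extend y y<1+c with m<1+n⇒m<n∨m≡n y<1+c
      ... | inj₁ y<c  = minimal y (subst (y <_) (sym eq) y<c)
      ... | inj₂ refl = miss

  μ<-sound : ∀ b → μ< P b < b → P (μ< P b) ≡ 0
  μ<-sound b lt with μ<-spec b
  ... | inj₁ (_ , hit) , _ = hit
  ... | inj₂ eq , _        = ⊥-elim (<-irrefl eq lt)

  μ<-complete : ∀ b y → y < b → P y ≡ 0 → μ< P b < b
  μ<-complete b y y<b hit with μ<-spec b
  ... | inj₁ (lt , _) , _ = lt
  ... | inj₂ eq , minimal = ⊥-elim (minimal y (subst (y <_) (sym eq) y<b) hit)

  μ<-minimal : ∀ b y → y < μ< P b → P y ≢ 0
  μ<-minimal b = proj₂ (μ<-spec b)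

searchᵗ : Total 3 → Total 2
searchᵗ p = realise (searchUpTo ⟨ π₀ ∷ π₀ ∷ π₁ ∷ [] ⟩)
  (λ { (b ∷ x ∷ []) → μ< (P b x) b }) λ { (b ∷ x ∷ []) → ⟦searchUpTo⟧ b b x }
  where
  P : ℕ → ℕ → ℕ → ℕ
  P b x y = ⟦ p ⟧ (y ∷ b ∷ x ∷ [])
  searchUpTo : Total 3
  searchUpTo = precᵗ zeroᵗ (+ᵗ ⟨ π₁ ∷ isZeroᵗ ⟨ +ᵗ ⟨ ∸ᵗ ⟨ π₀ ∷ π₁ ∷ [] ⟩ ∷
                 isZeroᵗ ⟨ p ⟨ π₀ ∷ π₂ ∷ π₃ ∷ [] ⟩ ∷ [] ⟩ ∷ [] ⟩ ∷ [] ⟩ ∷ [] ⟩)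
  ⟦searchUpTo⟧ : ∀ c b x → ⟦ searchUpTo ⟧ (c ∷ b ∷ x ∷ []) ≡ μ< (P b x) c
  ⟦searchUpTo⟧ zero    b x = refl
  ⟦searchUpTo⟧ (suc c) b x = cong (λ r → r + isZero ((c ∸ r) + isZero (P b x c))) (⟦searchUpTo⟧ c b x)

module _ {n} (t : Total (suc n)) (xs : Vec ℕ n) where

  private
    P : ℕ → ℕ
    P y = ⟦ t ⟧ (y ∷ xs)

  mu-converges : ∀ y → P y ≡ 0 → ∃ λ y₀ → Eval (mu ⌜ t ⌝) xs y₀
  mu-converges y hit = y₀ , ev-mu (subst (Eval ⌜ t ⌝ (y₀ ∷ xs)) (μ<-sound P (suc y) y₀<) (Eval-⟦⟧ t _)) earlier
    where
    y₀ : ℕ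
    y₀ = μ< P (suc y)
    y₀< : y₀ < suc y
    y₀< = μ<-complete P (suc y) y (n<1+n y) hit
    earlier : ∀ k → k < y₀ → ∃ λ r → Eval ⌜ t ⌝ (k ∷ xs) (suc r)
    earlier k k<y₀ with P k in Pk | μ<-minimal P (suc y) k k<y₀
    ... | zero  | miss = ⊥-elim (miss refl)
    ... | suc r | _    = r , subst (Eval ⌜ t ⌝ (k ∷ xs)) Pk (Eval-⟦⟧ t _)

  mu-sound : ∀ {y₀} → Eval (mu ⌜ t ⌝) xs y₀ → P y₀ ≡ 0
  mu-sound (ev-mu hit _) = sym (Eval⇒≡⟦⟧ t hit)

χ≥ : ℕ → ℕ → ℕ
χ≥ u b = isZero (b ∸ u)

χ≥ᵗ : Total 2
χ≥ᵗ = isZeroᵗ ⟨ ∸ᵗ ⟨ π₁ ∷ π₀ ∷ [] ⟩ ∷ [] ⟩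

χ≥≡0⇒< : ∀ {u b} → χ≥ u b ≡ 0 → u < b
χ≥≡0⇒< {u} {b} χ≡0 with u <? b
... | yes u<b = u<b
... | no  u≮b = ⊥-elim (isZero≡0⇒≢0 χ≡0 (m≤n⇒m∸n≡0 (≮⇒≥ u≮b)))

<⇒χ≥≡0 : ∀ {u b} → u < b → χ≥ u b ≡ 0
<⇒χ≥≡0 u<b = ≢0⇒isZero≡0 (m<n⇒n≢0 (m<n⇒0<n∸m u<b))

χ≡ : ℕ → ℕ → ℕ
χ≡ u y = isZero ((u ∸ y) + (y ∸ u))

χ≡ᵗ : Total 2
χ≡ᵗ = isZeroᵗ ⟨ +ᵗ ⟨ ∸ᵗ ⟨ π₀ ∷ π₁ ∷ [] ⟩ ∷ ∸ᵗ ⟨ π₁ ∷ π₀ ∷ [] ⟩ ∷ [] ⟩ ∷ [] ⟩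

χ≡≡0⇒≢ : ∀ {u y} → χ≡ u y ≡ 0 → u ≢ y
χ≡≡0⇒≢ {u} χ≡0 refl = isZero≡0⇒≢0 χ≡0 (cong₂ _+_ (n∸n≡0 u) (n∸n≡0 u))

≢⇒χ≡≡0 : ∀ {u y} → u ≢ y → χ≡ u y ≡ 0
≢⇒χ≡≡0 {u} {y} u≢y = ≢0⇒isZero≡0 λ sum≡0 →
  u≢y (≤-antisym (m∸n≡0⇒m≤n (m+n≡0⇒m≡0 (u ∸ y) sum≡0)) (m∸n≡0⇒m≤n (m+n≡0⇒n≡0 (u ∸ y) sum≡0)))

Bounded : ℕ → (ℕ → ℕ) → ℕ → Set
Bounded b e L = ∀ k → k ≤ L → e k < b

NonReturning : (ℕ → ℕ) → ℕ → Set
NonReturning e L = ∀ k → 1 ≤ k → k ≤ L → e k ≢ e 0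

defect : (ℕ → ℕ) → ℕ → ℕ → ℕ
defect e b zero    = χ≥ (e 0) b
defect e b (suc L) = defect e b L + (χ≥ (e (suc L)) b + χ≡ (e (suc L)) (e 0))

defect≡0⇒ : ∀ e b L → defect e b L ≡ 0 → Bounded b e L × NonReturning e L
defect≡0⇒ e b zero    d≡0 = (λ { zero _ → χ≥≡0⇒< d≡0 }) , λ { zero () ; (suc k) _ () }
defect≡0⇒ e b (suc L) d≡0 = bounded , nonReturning
  where
  earlier : Bounded b e L × NonReturning e L
  earlier = defect≡0⇒ e b L (m+n≡0⇒m≡0 (defect e b L) d≡0)
  last≡0 : χ≥ (e (suc L)) b + χ≡ (e (suc L)) (e 0) ≡ 0
  last≡0 = m+n≡0⇒n≡0 (defect e b L) d≡0
  bounded : Bounded b e (suc L)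
  bounded k k≤1+L with m≤n⇒m<n∨m≡n k≤1+L
  ... | inj₁ k<1+L = proj₁ earlier k (≤-pred k<1+L)
  ... | inj₂ refl  = χ≥≡0⇒< (m+n≡0⇒m≡0 (χ≥ (e k) b) last≡0)
  nonReturning : NonReturning e (suc L)
  nonReturning k 1≤k k≤1+L with m≤n⇒m<n∨m≡n k≤1+L
  ... | inj₁ k<1+L = proj₂ earlier k 1≤k (≤-pred k<1+L)
  ... | inj₂ refl  = χ≡≡0⇒≢ (m+n≡0⇒n≡0 (χ≥ (e k) b) last≡0)

⇒defect≡0 : ∀ e b L → Bounded b e L → NonReturning e L → defect e b L ≡ 0
⇒defect≡0 e b zero    bounded _            = <⇒χ≥≡0 (bounded 0 z≤n)
⇒defect≡0 e b (suc L) bounded nonReturning = cong₂ _+_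
  (⇒defect≡0 e b L (λ k k≤L → bounded k (m≤n⇒m≤1+n k≤L)) (λ k 1≤k k≤L → nonReturning k 1≤k (m≤n⇒m≤1+n k≤L)))
  (cong₂ _+_ (<⇒χ≥≡0 (bounded (suc L) ≤-refl)) (≢⇒χ≡≡0 (nonReturning (suc L) (s≤s z≤n) ≤-refl)))

bound-exists : ∀ (e : ℕ → ℕ) L → ∃ λ b → Bounded b e L
bound-exists e zero    = suc (e 0) , λ { zero _ → ≤-refl }
bound-exists e (suc L) with bound-exists e L
... | b , bounded = b ⊔ suc (e (suc L)) , below
  where
  below : Bounded (b ⊔ suc (e (suc L))) e (suc L)
  below k k≤1+L with m≤n⇒m<n∨m≡n k≤1+L
  ... | inj₁ k<1+L = ≤-trans (bounded k (≤-pred k<1+L)) (m≤m⊔n b _)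
  ... | inj₂ refl  = m≤n⊔m b _

+-offset< : ∀ i j m → m ≤ i → suc i * suc j + m < suc i * suc (suc j)
+-offset< i j m m≤i = begin-strict
  suc i * suc j + m      <⟨ +-monoʳ-< (suc i * suc j) (s≤s m≤i) ⟩
  suc i * suc j + suc i  ≡⟨ +-comm (suc i * suc j) (suc i) ⟩
  suc i + suc i * suc j  ≡⟨ *-suc (suc i) (suc j) ⟨
  suc i * suc (suc j)    ∎
  where open ≤-Reasoning

+-offset-fits : ∀ {i j n m} → j < n → m ≤ i → suc i * suc j + m < suc i * suc n
+-offset-fits {i} {j} {n} {m} j<n m≤i = ≤-trans (+-offset< i j m m≤i) (*-monoʳ-≤ (suc i) (s≤s j<n))

+-offset-injective : ∀ {i j k m} → m ≤ i → suc i * suc j + m ≡ suc i * suc k → j ≡ k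
+-offset-injective {i} {j} {k} {m} m≤i eq with <-cmp j k
... | tri≈ _ j≡k _ = j≡k
... | tri< j<k _ _ = ⊥-elim (<-irrefl eq (≤-trans (+-offset< i j m m≤i) (*-monoʳ-≤ (suc i) (s≤s j<k))))
... | tri> _ _ k<j = ⊥-elim (<-irrefl (sym eq) (<-≤-trans (*-monoʳ-< (suc i) (s≤s k<j)) (m≤m+n (suc i * suc j) m)))

join-injective : ∀ m n {s t : Fin m ⊎ Fin n} → join m n s ≡ join m n t → s ≡ t
join-injective m n {s} {t} eq = trans (sym (splitAt-join m n s)) (trans (cong (splitAt m) eq) (splitAt-join m n t))

module _ {C : ℕ → Set} where

  private
    ⊆*-⊤ : C ⊆* (λ _ → ⊤)
    ⊆*-⊤ = 0 , λ x (_ , ¬⊤) → ⊥-elim (¬⊤ tt)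

  ⊆*-zip : ∀ {X Y Z : ℕ → Set} → C ⊆* X → C ⊆* Y → ∀ N →
           (∀ i → N ≤ i → C i → X i → Y i → Z i) → C ⊆* Z
  ⊆*-zip {X} {Y} {Z} (Nx , outX) (Ny , outY) N combine = Nx ⊔ Ny ⊔ N , out
    where
    out : ∀ x → C x × ¬ Z x → x < Nx ⊔ Ny ⊔ N
    out x (cx , ¬z) with x <? Nx ⊔ Ny ⊔ N
    ... | yes x< = x<
    ... | no  x≮ = ⊥-elim (¬¬X λ xx → ¬¬Y λ yy → ¬z (combine x (≤-trans (m≤n⊔m (Nx ⊔ Ny) N) x≥) cx xx yy))
      where
      x≥ : Nx ⊔ Ny ⊔ N ≤ x
      x≥ = ≮⇒≥ x≮
      ¬¬X : ¬ ¬ X x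
      ¬¬X ¬x = <⇒≱ (outX x (cx , ¬x)) (≤-trans (≤-trans (m≤m⊔n Nx Ny) (m≤m⊔n (Nx ⊔ Ny) N)) x≥)
      ¬¬Y : ¬ ¬ Y x
      ¬¬Y ¬y = <⇒≱ (outY x (cx , ¬y)) (≤-trans (≤-trans (m≤n⊔m Nx Ny) (m≤m⊔n (Nx ⊔ Ny) N)) x≥)

  ⊆*-map : ∀ {X Z : ℕ → Set} → C ⊆* X → ∀ N → (∀ i → N ≤ i → C i → X i → Z i) → C ⊆* Z
  ⊆*-map C⊆*X N f = ⊆*-zip C⊆*X ⊆*-⊤ N (λ i N≤i ci x _ → f i N≤i ci x)

  ⊆*-cofinite : ∀ {Z : ℕ → Set} N → (∀ i → N ≤ i → C i → Z i) → C ⊆* Z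
  ⊆*-cofinite N f = ⊆*-map ⊆*-⊤ N (λ i N≤i ci _ → f i N≤i ci)

  ⊆*-refute : InfiniteSet C → ∀ {X : ℕ → Set} → C ⊆* X → ∀ N → (∀ i → N ≤ i → C i → ¬ X i) → ⊥
  ⊆*-refute infinite {X} (Nx , outX) N ¬X with infinite (Nx ⊔ N)
  ... | i , ≥Nx⊔N , ci = ¬¬X (¬X i (≤-trans (m≤n⊔m Nx N) ≥Nx⊔N) ci)
    where
    ¬¬X : ¬ ¬ X i
    ¬¬X ¬x = <⇒≱ (outX i (ci , ¬x)) (≤-trans (m≤m⊔n Nx N) ≥Nx⊔N)

-- Paths of a computable partial injection structure

module _ (𝒜 : CompPIS) where
  open CompPIS 𝒜

  F-functional : ∀ {x y y′} → F x y → F x y′ → y ≡ y′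
  F-functional = Eval-deterministic

  Steps : ℕ → ℕ → ℕ → Set
  Steps zero    u v = u ≡ v
  Steps (suc m) u v = ∃ λ w → F u w × Steps m w v

  Steps-functional : ∀ m {u v v′} → Steps m u v → Steps m u v′ → v ≡ v′
  Steps-functional zero    refl refl = refl
  Steps-functional (suc m) (w , f , r) (w′ , f′ , r′) with F-functional f f′
  ... | refl = Steps-functional m r r′

  Steps-injective : ∀ m {u u′ v} → Steps m u v → Steps m u′ v → u ≡ u′
  Steps-injective zero    refl refl = refl
  Steps-injective (suc m) (w , f , r) (w′ , f′ , r′) with Steps-injective m r r′
  ... | refl = f-inj _ _ _ f f′

  Steps-++ : ∀ m k {u v w} → Steps m u v → Steps k v w → Steps (m + k) u w
  Steps-++ zero    k refl r′        = r′
  Steps-++ (suc m) k (x , f , r) r′ = x , f , Steps-++ m k r r′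

  Steps-split : ∀ m k {u w} → Steps (m + k) u w → ∃ λ v → Steps m u v × Steps k v w
  Steps-split zero    k r = _ , refl , r
  Steps-split (suc m) k (x , f , r) with Steps-split m k r
  ... | v , p , q = v , (x , f , p) , q

  Steps-drop : ∀ m k {u v w} → Steps (m + k) u w → Steps m u v → Steps k v w
  Steps-drop m k r p with Steps-split m k r
  ... | _ , p′ , q rewrite Steps-functional m p p′ = q

  Steps-last : ∀ r {u z} → Steps (suc r) u z → ∃ λ y → Steps r u y × F y z
  Steps-last r {u} {z} p with Steps-split r 1 (subst (λ m → Steps m u z) (+-comm 1 r) p)
  ... | y , q , (z′ , f , refl) = y , q , f

  Steps-along : ∀ (e : ℕ → ℕ) D → (∀ k → k < D → F (e k) (e (suc k))) →
                ∀ m a → a + m ≤ D → Steps m (e a) (e (a + m))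
  Steps-along e D step zero    a _     = cong e (sym (+-identityʳ a))
  Steps-along e D step (suc m) a a+m<D =
    e (suc a) , step a (≤-trans (s≤s (m≤m+n a m)) a+m<D′) ,
    subst (λ z → Steps m (e (suc a)) (e z)) (sym (+-suc a m)) (Steps-along e D step m (suc a) a+m<D′)
    where
    a+m<D′ : suc a + m ≤ D
    a+m<D′ = subst (_≤ D) (+-suc a m) a+m<D

  Path : (ℕ → ℕ) → ℕ → Set
  Path e L = (∀ k → k < L → F (e k) (e (suc k))) × NonReturning e L

  -- A repetition e a ≡ e c is pulled back along f⁻¹ to a return e (c ∸ a) ≡ e 0.
  Path-no-repeat : ∀ {e L} → Path e L → ∀ {a c} → a < c → c ≤ L → e a ≢ e c
  Path-no-repeat {e} {L} (step , nonReturning) {a} {c} a<c c≤L ea≡ec =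
    nonReturning (c ∸ a) (m<n⇒0<n∸m a<c) (≤-trans (m∸n≤m c a) c≤L) (back a c a<c c≤L ea≡ec)
    where
    back : ∀ a c → a < c → c ≤ L → e a ≡ e c → e (c ∸ a) ≡ e 0
    back zero    c       _         _   ea≡ec = sym ea≡ec
    back (suc a) (suc c) (s≤s a<c) c<L ea≡ec = back a c a<c (≤-trans (n≤1+n c) c<L)
      (f-inj _ _ _ (step a (≤-trans (s≤s (<⇒≤ a<c)) c<L)) (subst (F (e c)) (sym ea≡ec) (step c c<L)))

  Path-injective : ∀ {e L} → Path e L → ∀ a c → a ≤ L → c ≤ L → e a ≡ e c → a ≡ c
  Path-injective path a c a≤L c≤L ea≡ec with <-cmp a c
  ... | tri< a<c _ _ = ⊥-elim (Path-no-repeat path a<c c≤L ea≡ec)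
  ... | tri≈ _ a≡c _ = a≡c
  ... | tri> _ _ c<a = ⊥-elim (Path-no-repeat path c<a a≤L (sym ea≡ec))

  Path-Steps : ∀ {e L} → Path e L → ∀ m a → a + m ≤ L → Steps m (e a) (e (a + m))
  Path-Steps {e} {L} (step , _) = Steps-along e L step

  HasLongPaths : Set
  HasLongPaths = ∀ L → ∃ λ e → Path e L

  𝑆 : Str
  𝑆 = structure 𝒜

  Iter⇒Steps : ∀ d {x y} → Iter 𝑆 d x y → Steps d (proj₁ x) (proj₁ y)
  Iter⇒Steps zero    x≡y               = x≡y
  Iter⇒Steps (suc d) (c , fx≡c , iter) = proj₁ c , fx≡c , Iter⇒Steps d iter

  Steps⇒Iter : ∀ d x y → Steps d (proj₁ x) (proj₁ y) → Iter 𝑆 d x y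
  Steps⇒Iter zero    x y x≡y               = x≡y
  Steps⇒Iter (suc d) x y (w , fx≡w , steps) = (w , proj₂ (f-into _ _ fx≡w)) , fx≡w , Steps⇒Iter d _ y steps

  Steps-between : ∀ {d₁ d₂ v x y} → Steps d₁ v x → Steps d₂ v y → ∃ λ d → Steps d x y ⊎ Steps d y x
  Steps-between {d₁} {d₂} v→x v→y with ≤-total d₁ d₂
  ... | inj₁ d₁≤d₂ = d₂ ∸ d₁ , inj₁ (Steps-drop d₁ (d₂ ∸ d₁) (subst (λ m → Steps m _ _) (sym (m+[n∸m]≡n d₁≤d₂)) v→y) v→x)
  ... | inj₂ d₂≤d₁ = d₁ ∸ d₂ , inj₂ (Steps-drop d₂ (d₁ ∸ d₂) (subst (λ m → Steps m _ _) (sym (m+[n∸m]≡n d₂≤d₁)) v→x) v→y)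

  Steps-between⁻ : ∀ {d₁ d₂ v x y} → Steps d₁ x v → Steps d₂ y v → ∃ λ d → Steps d x y ⊎ Steps d y x
  Steps-between⁻ {d₁} {d₂} x→v y→v with ≤-total d₁ d₂
  ... | inj₁ d₁≤d₂ with Steps-split (d₂ ∸ d₁) d₁ (subst (λ m → Steps m _ _) (sym (m∸n+n≡m d₁≤d₂)) y→v)
  ...   | z , y→z , z→v rewrite Steps-injective d₁ z→v x→v = d₂ ∸ d₁ , inj₂ y→z
  Steps-between⁻ {d₁} {d₂} x→v y→v | inj₂ d₂≤d₁
        with Steps-split (d₁ ∸ d₂) d₂ (subst (λ m → Steps m _ _) (sym (m∸n+n≡m d₂≤d₁)) x→v)
  ...   | z , x→z , z→v rewrite Steps-injective d₂ z→v y→v = d₁ ∸ d₂ , inj₁ x→z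

  co-orbital-Steps : ∀ {v x y} → InOrbit 𝑆 v x → InOrbit 𝑆 v y →
                     ∃ λ d → Steps d (proj₁ x) (proj₁ y) ⊎ Steps d (proj₁ y) (proj₁ x)
  co-orbital-Steps (d₁ , inj₁ v→x) (d₂ , inj₁ v→y) = Steps-between (Iter⇒Steps d₁ v→x) (Iter⇒Steps d₂ v→y)
  co-orbital-Steps (d₁ , inj₂ x→v) (d₂ , inj₂ y→v) = Steps-between⁻ (Iter⇒Steps d₁ x→v) (Iter⇒Steps d₂ y→v)
  co-orbital-Steps (d₁ , inj₂ x→v) (d₂ , inj₁ v→y) = d₁ + d₂ , inj₁ (Steps-++ d₁ d₂ (Iter⇒Steps d₁ x→v) (Iter⇒Steps d₂ v→y))
  co-orbital-Steps (d₁ , inj₁ v→x) (d₂ , inj₂ y→v) = d₂ + d₁ , inj₂ (Steps-++ d₂ d₁ (Iter⇒Steps d₂ y→v) (Iter⇒Steps d₁ v→x))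

  InOrbit-common : ∀ {v x y} → InOrbit 𝑆 v x → InOrbit 𝑆 v y → InOrbit 𝑆 x y
  InOrbit-common {x = x} {y} v~x v~y with co-orbital-Steps v~x v~y
  ... | d , inj₁ x→y = d , inj₁ (Steps⇒Iter d x y x→y)
  ... | d , inj₂ y→x = d , inj₂ (Steps⇒Iter d y x y→x)

  χF : ℕ → ℕ → ℕ
  χF x z with χG-total x z
  ... | inj₁ _ = 0
  ... | inj₂ _ = 1

  χFᵗ : Total 2
  χFᵗ = embedᵗ χG (λ { (x ∷ z ∷ []) → χF x z }) λ { (x ∷ z ∷ []) → Eval-χF x z }
    where
    Eval-χF : ∀ x z → Eval χG (x ∷ z ∷ []) (χF x z)
    Eval-χF x z with χG-total x z
    ... | inj₁ χG≡0 = χG≡0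
    ... | inj₂ χG≡1 = χG≡1

  isZero-χF≡0⇒F : ∀ x z → isZero (χF x z) ≡ 0 → F x z
  isZero-χF≡0⇒F x z _ with χG-total x z
  isZero-χF≡0⇒F x z () | inj₁ _
  ... | inj₂ χG≡1 = χG-spec₁ x z χG≡1

  F⇒isZero-χF≡0 : ∀ x z → F x z → isZero (χF x z) ≡ 0
  F⇒isZero-χF≡0 x z fxz with χG-total x z
  ... | inj₂ _    = refl
  ... | inj₁ χG≡0 with Eval-deterministic χG≡0 (χG-spec₂ x z fxz)
  ... | ()

  ¬Fᵗ : Total 2
  ¬Fᵗ = isZeroᵗ ⟨ χFᵗ ⟨ π₀ ∷ π₁ ∷ [] ⟩ ∷ [] ⟩

  next : ℕ → ℕ → ℕ
  next b x = μ< (λ z → isZero (χF x z)) b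

  nextᵗ : Total 2
  nextᵗ = searchᵗ (¬Fᵗ ⟨ π₂ ∷ π₀ ∷ [] ⟩)

  next-sound : ∀ b x → next b x < b → F x (next b x)
  next-sound b x lt = isZero-χF≡0⇒F x _ (μ<-sound _ b lt)

  next-complete : ∀ b x z → F x z → z < b → next b x ≡ z
  next-complete b x z fxz z<b =
    F-functional (next-sound b x (μ<-complete _ b z z<b (F⇒isZero-χF≡0 x z fxz))) fxz

  walk : ℕ → ℕ → ℕ → ℕ
  walk b zero    y = y
  walk b (suc k) y = next b (walk b k y)

  walkᵗ : Total 3
  walkᵗ = realise iterate (λ { (k ∷ b ∷ y ∷ []) → walk b k y }) λ { (k ∷ b ∷ y ∷ []) → ⟦iterate⟧ k b y }
    where
    iterate : Total 3
    iterate = precᵗ π₁ (nextᵗ ⟨ π₂ ∷ π₁ ∷ [] ⟩)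
    ⟦iterate⟧ : ∀ k b y → ⟦ iterate ⟧ (k ∷ b ∷ y ∷ []) ≡ walk b k y
    ⟦iterate⟧ zero    b y = refl
    ⟦iterate⟧ (suc k) b y = cong (next b) (⟦iterate⟧ k b y)

  walk-Path : ∀ b y L → defect (λ k → walk b k y) b L ≡ 0 → Path (λ k → walk b k y) L
  walk-Path b y L d≡0 with defect≡0⇒ (λ k → walk b k y) b L d≡0
  ... | bounded , nonReturning = (λ k k<L → next-sound b (walk b k y) (bounded (suc k) k<L)) , nonReturning

  walk-follows : ∀ {e L} b → Path e L → Bounded b e L → ∀ k → k ≤ L → walk b k (e 0) ≡ e k
  walk-follows b path bounded zero    _     = refl
  walk-follows b path bounded (suc k) k<L =
    trans (cong (next b) (walk-follows b path bounded k (≤-trans (n≤1+n k) k<L)))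
          (next-complete b _ _ (proj₁ path k k<L) (bounded (suc k) k<L))

  defectᵗ : Total 3
  defectᵗ = realise accumulate (λ { (L ∷ b ∷ y ∷ []) → defect (λ k → walk b k y) b L })
    λ { (L ∷ b ∷ y ∷ []) → ⟦accumulate⟧ L b y }
    where
    w : Total 4
    w = walkᵗ ⟨ sucᵗ ⟨ π₀ ∷ [] ⟩ ∷ π₂ ∷ π₃ ∷ [] ⟩
    accumulate : Total 3
    accumulate = precᵗ (χ≥ᵗ ⟨ π₁ ∷ π₀ ∷ [] ⟩) (+ᵗ ⟨ π₁ ∷ +ᵗ ⟨ χ≥ᵗ ⟨ w ∷ π₂ ∷ [] ⟩ ∷ χ≡ᵗ ⟨ w ∷ π₃ ∷ [] ⟩ ∷ [] ⟩ ∷ [] ⟩)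
    ⟦accumulate⟧ : ∀ L b y → ⟦ accumulate ⟧ (L ∷ b ∷ y ∷ []) ≡ defect (λ k → walk b k y) b L
    ⟦accumulate⟧ zero    b y = refl
    ⟦accumulate⟧ (suc L) b y =
      cong (_+ (χ≥ (walk b (suc L) y) b + χ≡ (walk b (suc L) y) y)) (⟦accumulate⟧ L b y)

  defect-cong : ∀ {e e′} b L → (∀ k → k ≤ L → e k ≡ e′ k) → defect e b L ≡ defect e′ b L
  defect-cong {e} {e′} b zero    e≗e′ = cong (λ u → χ≥ u b) (e≗e′ 0 z≤n)
  defect-cong {e} {e′} b (suc L) e≗e′ = cong₂ _+_ (defect-cong b L (λ k k≤L → e≗e′ k (m≤n⇒m≤1+n k≤L)))
    (cong₂ (λ u v → χ≥ u b + χ≡ u v) (e≗e′ (suc L) ≤-refl) (e≗e′ 0 z≤n))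

  scaleᵗ : ℕ → Total 1
  scaleᵗ j = *ᵗ ⟨ sucᵗ ⟨ π₀ ∷ [] ⟩ ∷ constᵗ (suc j) ∷ [] ⟩

  -- Uniformly in i, search for a bound b and a start whose walk below b is a path of
  -- length (1+i)(1+n); ψ j reads off its point at position (1+i)(1+j).
  module PathSearch (n : ℕ) (long : HasLongPaths) where

    len : ℕ → ℕ
    len i = suc i * suc n

    pos : ℕ → ℕ → ℕ
    pos j i = suc i * suc j

    startᵗ : Total 2
    startᵗ = searchᵗ (defectᵗ ⟨ scaleᵗ n ⟨ π₂ ∷ [] ⟩ ∷ π₁ ∷ π₀ ∷ [] ⟩)

    start : ℕ → ℕ → ℕ
    start b i = ⟦ startᵗ ⟧ (b ∷ i ∷ [])

    boundᵗ : Total 2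
    boundᵗ = defectᵗ ⟨ scaleᵗ n ⟨ π₁ ∷ [] ⟩ ∷ π₀ ∷ startᵗ ∷ [] ⟩

    ψᵗ : ℕ → Total 2
    ψᵗ j = walkᵗ ⟨ scaleᵗ j ⟨ π₁ ∷ [] ⟩ ∷ π₀ ∷ startᵗ ∷ [] ⟩

    ψ : ℕ → PR 1
    ψ j = comp ⌜ ψᵗ j ⌝ (lookup (mu ⌜ boundᵗ ⌝ ∷ proj fzero ∷ []))

    -- Any path of length len i, bounded by b, makes its own start a witness below b.
    bound-witness : ∀ i → ∃ λ b → ⟦ boundᵗ ⟧ (b ∷ i ∷ []) ≡ 0
    bound-witness i with long (len i)
    ... | e , path with bound-exists e (len i)
    ... | b , bounded = b , μ<-sound (qualifies b) b (μ<-complete (qualifies b) b (e 0) (bounded 0 z≤n) e₀-qualifies)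
      where
      qualifies : ℕ → ℕ → ℕ
      qualifies b y = defect (λ k → walk b k y) b (len i)
      e₀-qualifies : qualifies b (e 0) ≡ 0
      e₀-qualifies = trans (defect-cong b (len i) (walk-follows b path bounded))
                           (⇒defect≡0 e b (len i) bounded (proj₂ path))

    bound-converges : ∀ i → ∃ λ b → Eval (mu ⌜ boundᵗ ⌝) (i ∷ []) b
    bound-converges i = mu-converges boundᵗ (i ∷ []) (proj₁ (bound-witness i)) (proj₂ (bound-witness i))

    path : ℕ → ℕ → ℕ
    path i k = walk (proj₁ (bound-converges i)) k (start (proj₁ (bound-converges i)) i)

    path-Path : ∀ i → Path (path i) (len i)
    path-Path i = walk-Path _ _ (len i) (mu-sound boundᵗ (i ∷ []) (proj₂ (bound-converges i)))

    Eval-ψ : ∀ j i → Eval (ψ j) (i ∷ []) (path i (pos j i))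
    Eval-ψ j i = ev-comp (proj₁ (bound-converges i) ∷ i ∷ [])
      (λ { fzero → proj₂ (bound-converges i) ; (fsuc fzero) → ev-proj }) (Eval-⟦⟧ (ψᵗ j) _)

  -- Long paths from each hypothesis

  Steps-snoc : ∀ r {u y z} → Steps r u y → F y z → Steps (suc r) u z
  Steps-snoc r {u} {z = z} steps fy≡z = subst (λ m → Steps m u z) (+-comm r 1) (Steps-++ r 1 steps (z , fy≡z , refl))

  Steps-repeat : ∀ k {a} → Steps k a a → ∀ t → Steps (t * k) a a
  Steps-repeat k cycle zero    = refl
  Steps-repeat k cycle (suc t) = Steps-++ k (t * k) cycle (Steps-repeat k cycle t)

  Steps-cycle-along : ∀ k d {x a} → Steps k x x → Steps d x a → Steps k a a
  Steps-cycle-along k d {x} {a} cycle steps with Steps-split d k (subst (λ m → Steps m x a) (+-comm k d) (Steps-++ k d cycle steps))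
  ... | z , x→z , z→a rewrite Steps-functional d x→z steps = z→a

  module _ {a k} (cycle : Steps (suc k) a a) where

    Steps-residue : ∀ d {w} → Steps d a w → ∃ λ r → r < suc k × Steps r a w
    Steps-residue zero    a≡w   = 0 , s≤s z≤n , a≡w
    Steps-residue (suc d) steps with Steps-last d steps
    ... | y , a→y , fy≡w with Steps-residue d a→y
    ...   | r , r<1+k , a→ʳy with m≤n⇒m<n∨m≡n r<1+k
    ...     | inj₁ 1+r<1+k = suc r , 1+r<1+k , Steps-snoc r a→ʳy fy≡w
    ...     | inj₂ refl     = 0 , s≤s z≤n , Steps-functional (suc k) cycle (Steps-snoc r a→ʳy fy≡w)

    -- Going d steps back from a is going d·k steps forward.
    Steps-backward : ∀ d {w} → Steps d w a → Steps (d * suc k ∸ d) a w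
    Steps-backward d {w} w→a with Steps-split (d * suc k ∸ d) d
           (subst (λ m → Steps m a a) (sym (m∸n+n≡m (m≤m*n d (suc k)))) (Steps-repeat (suc k) cycle d))
    ... | z , a→z , z→a rewrite Steps-injective d z→a w→a = a→z

  orbit-residue : ∀ {x} k → Steps (suc k) (proj₁ x) (proj₁ x) →
                  ∀ {w} → InOrbit 𝑆 x w → ∃ λ r → r < suc k × Steps r (proj₁ x) (proj₁ w)
  orbit-residue k cycle (d , inj₁ iter) = Steps-residue cycle d (Iter⇒Steps d iter)
  orbit-residue k cycle (d , inj₂ iter) = Steps-residue cycle _ (Steps-backward cycle d (Iter⇒Steps d iter))

  -- A cycle of length 1+k would confine the orbit to at most 1+k points.
  infinite-orbit-acyclic : ∀ {x} → InfiniteOrbit 𝑆 x → ∀ k → ¬ Steps (suc k) (proj₁ x) (proj₁ x)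
  infinite-orbit-acyclic {x} infinite k cycle with infinite (suc (suc k))
  ... | w , inOrbit , distinct =
    let (i , j , i<j , same) = pigeonhole ≤-refl (λ i → fromℕ< (proj₁ (proj₂ (residue i))))
        rᵢ≡rⱼ = fromℕ<-injective _ _ _ _ same
    in <-irrefl (cong toℕ (distinct i j (Steps-functional (proj₁ (residue i)) (proj₂ (proj₂ (residue i)))
         (subst (λ r → Steps r (proj₁ x) (proj₁ (w j))) (sym rᵢ≡rⱼ) (proj₂ (proj₂ (residue j))))))) i<j
    where
    residue : ∀ i → ∃ λ r → r < suc k × Steps r (proj₁ x) (proj₁ (w i))
    residue i = orbit-residue k cycle (inOrbit i)

  trace : ∀ {d u v} → Steps d u v → ℕ → ℕ
  trace {u = u} _                 zero    = u
  trace {zero}  {u} _              (suc k) = u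
  trace {suc d} (_ , _ , steps)    (suc k) = trace steps k

  trace-step : ∀ {d u v} (steps : Steps d u v) k → k < d → F (trace steps k) (trace steps (suc k))
  trace-step {suc d} (_ , fu≡w , steps) zero    _         = fu≡w
  trace-step {suc d} (_ , _    , steps) (suc k) (s≤s k<d) = trace-step steps k k<d

  acyclic-trace-Path : ∀ {L u v} → (∀ k → ¬ Steps (suc k) u u) → (steps : Steps L u v) → Path (trace steps) L
  acyclic-trace-Path {L} {u} acyclic steps = trace-step steps , λ
    { zero    () _
    ; (suc k) _  k<L returns → acyclic k (subst (Steps (suc k) u) returns
                                  (Steps-along (trace steps) L (trace-step steps) (suc k) 0 k<L)) }

  far-Path : ∀ {x w} → InfiniteOrbit 𝑆 x → ∀ L → (o : InOrbit 𝑆 x w) → L ≤ proj₁ o → ∃ λ e → Path e L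
  far-Path {x} {w} infinite L (d , inj₁ iter) L≤d
    with Steps-split L (d ∸ L) (subst (λ m → Steps m (proj₁ x) (proj₁ w)) (sym (m+[n∸m]≡n L≤d)) (Iter⇒Steps d iter))
  ... | y , x→y , _ = trace x→y , acyclic-trace-Path (infinite-orbit-acyclic infinite) x→y
  far-Path {x} {w} infinite L (d , inj₂ iter) L≤d
    with Steps-split (d ∸ L) L (subst (λ m → Steps m (proj₁ w) (proj₁ x)) (sym (m∸n+n≡m L≤d)) (Iter⇒Steps d iter))
  ... | y , _ , y→x = trace y→x ,
    acyclic-trace-Path (λ k cycle → infinite-orbit-acyclic infinite k (Steps-cycle-along (suc k) L cycle y→x)) y→x

  near-code : ∀ {x w} L → (o : InOrbit 𝑆 x w) → proj₁ o < L → Fin (L + L)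
  near-code L (d , inj₁ _) d<L = join L L (inj₁ (fromℕ< d<L))
  near-code L (d , inj₂ _) d<L = join L L (inj₂ (fromℕ< d<L))

  near-code-injective : ∀ {x w w′} L (o : InOrbit 𝑆 x w) (o′ : InOrbit 𝑆 x w′) d<L d′<L →
                        near-code L o d<L ≡ near-code L o′ d′<L → proj₁ w ≡ proj₁ w′
  near-code-injective L (d , inj₁ iter) (d′ , inj₁ iter′) d<L d′<L same
    with fromℕ<-injective d d′ d<L d′<L (inj₁-injective (join-injective L L same))
  ... | refl = Steps-functional d (Iter⇒Steps d iter) (Iter⇒Steps d iter′)
  near-code-injective L (d , inj₂ iter) (d′ , inj₂ iter′) d<L d′<L same
    with fromℕ<-injective d d′ d<L d′<L (inj₂-injective (join-injective L L same))
  ... | refl = Steps-injective d (Iter⇒Steps d iter) (Iter⇒Steps d iter′)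
  near-code-injective L (d , inj₁ _) (d′ , inj₂ _) d<L d′<L same
    with join-injective L L {inj₁ (fromℕ< d<L)} {inj₂ (fromℕ< d′<L)} same
  ... | ()
  near-code-injective L (d , inj₂ _) (d′ , inj₁ _) d<L d′<L same
    with join-injective L L {inj₂ (fromℕ< d<L)} {inj₁ (fromℕ< d′<L)} same
  ... | ()

  -- Of 1 + 2L distinct points of the orbit, one lies at distance at least L from x.
  infinite-orbit-paths : HasInfiniteOrbit 𝑆 → HasLongPaths
  infinite-orbit-paths (x , infinite) L with infinite (suc (L + L))
  ... | w , inOrbit , distinct with any? (λ i → L ≤? proj₁ (inOrbit i))
  ...   | yes (i , L≤d) = far-Path infinite L (inOrbit i) L≤d
  ...   | no  allNear   =
    let (i , j , i<j , same) = pigeonhole ≤-refl (λ i → near-code L (inOrbit i) (near i))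
    in ⊥-elim (<-irrefl (cong toℕ (distinct i j (near-code-injective L (inOrbit i) (inOrbit j) _ _ same))) i<j)
    where
    near : ∀ i → proj₁ (inOrbit i) < L
    near i = ≰⇒> (λ L≤d → allNear (i , L≤d))

  module _ {m} (v : Fin (suc m) → Str.Carrier 𝑆) (distinct : ∀ i j → proj₁ (v i) ≡ proj₁ (v j) → i ≡ j)
           (step : ∀ (i : Fin m) → F (proj₁ (v (inject₁ i))) (proj₁ (v (fsuc i)))) where

    -- positions beyond m are sent to 0; only positions ≤ L ≤ m matter
    clamp : ℕ → Fin (suc m)
    clamp k with k <? suc m
    ... | yes k<1+m = fromℕ< k<1+m
    ... | no  _     = fzero

    toℕ-clamp : ∀ k → k < suc m → toℕ (clamp k) ≡ k
    toℕ-clamp k k<1+m with k <? suc m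
    ... | yes _     = toℕ-fromℕ< k<1+m
    ... | no  k≮1+m = ⊥-elim (k≮1+m k<1+m)

    finite-Path : ∀ L → L ≤ m → Path (λ k → proj₁ (v (clamp k))) L
    finite-Path L L≤m = stepᴸ , nonReturning
      where
      stepᴸ : ∀ k → k < L → F (proj₁ (v (clamp k))) (proj₁ (v (clamp (suc k))))
      stepᴸ k k<L = subst₂ (λ a b → F (proj₁ (v a)) (proj₁ (v b))) at-k at-1+k (step (fromℕ< k<m))
        where
        k<m : k < m
        k<m = ≤-trans k<L L≤m
        at-k : inject₁ (fromℕ< k<m) ≡ clamp k
        at-k = toℕ-injective (trans (toℕ-inject₁ _) (trans (toℕ-fromℕ< k<m) (sym (toℕ-clamp k (m<n⇒m<1+n k<m)))))
        at-1+k : fsuc (fromℕ< k<m) ≡ clamp (suc k)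
        at-1+k = toℕ-injective (trans (cong suc (toℕ-fromℕ< k<m)) (sym (toℕ-clamp (suc k) (s≤s k<m))))
      nonReturning : NonReturning (λ k → proj₁ (v (clamp k))) L
      nonReturning k 1≤k k≤L returns = <-irrefl (sym k≡0) 1≤k
        where
        k≡0 : k ≡ 0
        k≡0 = trans (sym (toℕ-clamp k (s≤s (≤-trans k≤L L≤m)))) (cong toℕ (distinct _ _ returns))

  cycles-paths : UnboundedCycleCharacter 𝑆 → HasLongPaths
  cycles-paths unbounded L with unbounded L
  ... | m , L≤m , v , distinct , step , _ = _ , finite-Path v distinct step L L≤m

  chains-paths : UnboundedFiniteChainCharacter 𝑆 → HasLongPaths
  chains-paths unbounded L with unbounded L
  ... | m , L≤m , v , distinct , step , _ = _ , finite-Path v distinct step L L≤m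

  -- The cohesive power

  f∘ : PR 1 → PR 1
  f∘ e = comp fᶜ (λ _ → e)

  Eval-f∘ : ∀ {e i v} → Eval (f∘ e) (i ∷ []) v → ∃ λ u → Eval e (i ∷ []) u × F u v
  Eval-f∘ (ev-comp (u ∷ []) e↦u fu≡v) = u , e↦u fzero , fu≡v

  f∘-converges : ∀ {e i u v} → Eval e (i ∷ []) u → F u v → Eval (f∘ e) (i ∷ []) v
  f∘-converges {u = u} e↦u fu≡v = ev-comp (u ∷ []) (λ { fzero → e↦u }) fu≡v

  f⁻¹∘ : PR 1 → PR 1
  f⁻¹∘ e = comp (mu ⌜ ¬Fᵗ ⌝) (λ _ → e)

  Eval-f⁻¹∘ : ∀ {e i v} → Eval (f⁻¹∘ e) (i ∷ []) v → ∃ λ x → Eval e (i ∷ []) x × F v x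
  Eval-f⁻¹∘ {v = v} (ev-comp (x ∷ []) e↦x search) =
    x , e↦x fzero , isZero-χF≡0⇒F v x (mu-sound ¬Fᵗ (x ∷ []) search)

  f⁻¹∘-converges : ∀ {e i x z} → Eval e (i ∷ []) x → F z x → f⁻¹∘ e ↓ i
  f⁻¹∘-converges {x = x} {z} e↦x fz≡x
    with mu-converges ¬Fᵗ (x ∷ []) z (F⇒isZero-χF≡0 z x fz≡x)
  ... | y , search = y , ev-comp (x ∷ []) (λ { fzero → e↦x }) search

  module _ (C : ℕ → Set) where

    Π : Str
    Π = CohesivePower 𝒜 C

    Elt : Set
    Elt = PowElt 𝒜 C

    _≈ᴾ_ : Elt → Elt → Set
    _≈ᴾ_ = Str._≈_ Π

    Gᴾ : Elt → Elt → Set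
    Gᴾ = Str.G Π

    _at_↦_ : Elt → ℕ → ℕ → Set
    a at i ↦ v = Eval (PowElt.code a) (i ∷ []) v

    SameAt : Elt → Elt → ℕ → Set
    SameAt a b i = ∃ λ v → a at i ↦ v × b at i ↦ v

    EdgeAt : Elt → Elt → ℕ → Set
    EdgeAt a b i = ∃ λ u → ∃ λ v → a at i ↦ u × b at i ↦ v × F u v

    ≈ᴾ-refl : ∀ a → a ≈ᴾ a
    ≈ᴾ-refl a = ⊆*-map (PowElt.dom-C a) 0 (λ i _ _ (v , a↦v) → v , a↦v , a↦v)

    fᴾ : (a : Elt) → C ⊆* (λ i → f∘ (PowElt.code a) ↓ i) → Elt
    fᴾ a dom = record
      { code   = f∘ (PowElt.code a)
      ; into-A = λ i v fa↦v → proj₂ (f-into _ _ (proj₂ (proj₂ (Eval-f∘ fa↦v))))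
      ; dom-C  = dom }

    Gᴾ-fᴾ : ∀ a dom → Gᴾ a (fᴾ a dom)
    Gᴾ-fᴾ a dom = ⊆*-map dom 0 λ i _ _ (v , fa↦v) →
      let (u , a↦u , fu≡v) = Eval-f∘ fa↦v in u , v , a↦u , fa↦v , fu≡v

    f⁻¹ᴾ : (a : Elt) → C ⊆* (λ i → f⁻¹∘ (PowElt.code a) ↓ i) → Elt
    f⁻¹ᴾ a dom = record
      { code   = f⁻¹∘ (PowElt.code a)
      ; into-A = λ i v f⁻¹a↦v → proj₁ (f-into _ _ (proj₂ (proj₂ (Eval-f⁻¹∘ f⁻¹a↦v))))
      ; dom-C  = dom }

    Gᴾ-f⁻¹ᴾ : ∀ a dom → Gᴾ (f⁻¹ᴾ a dom) a
    Gᴾ-f⁻¹ᴾ a dom = ⊆*-map dom 0 λ i _ _ (v , f⁻¹a↦v) →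
      let (x , a↦x , fv≡x) = Eval-f⁻¹∘ f⁻¹a↦v in v , x , f⁻¹a↦v , a↦x , fv≡x

    StepsOnC : ℕ → Elt → Elt → Set
    StepsOnC m a b = C ⊆* (λ i → ∃ λ u → ∃ λ v → a at i ↦ u × b at i ↦ v × Steps m u v)

    Iter⇒StepsOnC : ∀ m a b → Iter Π m a b → StepsOnC m a b
    Iter⇒StepsOnC zero    a b a≈b = ⊆*-map a≈b 0 (λ i _ _ (v , a↦v , b↦v) → v , v , a↦v , b↦v , refl)
    Iter⇒StepsOnC (suc m) a b (c , Gac , iter) = ⊆*-zip Gac (Iter⇒StepsOnC m c b iter) 0
      λ i _ _ (u , w , a↦u , c↦w , fu≡w) (w′ , v , c↦w′ , b↦v , steps) →
        u , v , a↦u , b↦v , (w , fu≡w , subst (λ z → Steps m z v) (Eval-deterministic c↦w′ c↦w) steps)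

    ≈ᴾ-sym : ∀ a b → a ≈ᴾ b → b ≈ᴾ a
    ≈ᴾ-sym a b a≈b = ⊆*-map a≈b 0 (λ i _ _ (v , a↦v , b↦v) → v , b↦v , a↦v)

    ≈ᴾ-trans : ∀ a b c → a ≈ᴾ b → b ≈ᴾ c → a ≈ᴾ c
    ≈ᴾ-trans a b c a≈b b≈c = ⊆*-zip a≈b b≈c 0 λ i _ _ (v , a↦v , b↦v) (v′ , b↦v′ , c↦v′) →
      v′ , subst (a at i ↦_) (Eval-deterministic b↦v b↦v′) a↦v , c↦v′

    Gᴾ-resp : ∀ a a′ c c′ → a′ ≈ᴾ a → Gᴾ a c → c ≈ᴾ c′ → Gᴾ a′ c′
    Gᴾ-resp a a′ c c′ a′≈a Gac c≈c′ = ⊆*-zip (⊆*-zip a′≈a Gac 0 left) c≈c′ 0 right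
      where
      left : ∀ i → 0 ≤ i → C i → SameAt a′ a i → EdgeAt a c i → EdgeAt a′ c i
      left i _ _ (u′ , a′↦u′ , a↦u′) (u , v , a↦u , c↦v , fu≡v) =
        u , v , subst (a′ at i ↦_) (Eval-deterministic a↦u′ a↦u) a′↦u′ , c↦v , fu≡v
      right : ∀ i → 0 ≤ i → C i → EdgeAt a′ c i → SameAt c c′ i → EdgeAt a′ c′ i
      right i _ _ (u , v , a′↦u , c↦v , fu≡v) (v′ , c↦v′ , c′↦v′) =
        u , v′ , a′↦u , c′↦v′ , subst (F u) (Eval-deterministic c↦v c↦v′) fu≡v

    Iter-resp : ∀ m a a′ b b′ → a′ ≈ᴾ a → Iter Π m a b → b ≈ᴾ b′ → Iter Π m a′ b′
    Iter-resp zero    a a′ b b′ a′≈a a≈b b≈b′ = ≈ᴾ-trans a′ a b′ a′≈a (≈ᴾ-trans a b b′ a≈b b≈b′)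
    Iter-resp (suc m) a a′ b b′ a′≈a (c , Gac , iter) b≈b′ =
      c , Gᴾ-resp a a′ c c a′≈a Gac (≈ᴾ-refl c) , Iter-resp m c c b b′ (≈ᴾ-refl c) iter b≈b′

    InOrbit-resp : ∀ a a′ b b′ → a′ ≈ᴾ a → InOrbit Π a b → b ≈ᴾ b′ → InOrbit Π a′ b′
    InOrbit-resp a a′ b b′ a′≈a (m , inj₁ iter) b≈b′ = m , inj₁ (Iter-resp m a a′ b b′ a′≈a iter b≈b′)
    InOrbit-resp a a′ b b′ a′≈a (m , inj₂ iter) b≈b′ =
      m , inj₂ (Iter-resp m b b′ a a′ (≈ᴾ-sym b b′ b≈b′) iter (≈ᴾ-sym a′ a a′≈a))

    IsZChain-resp : ∀ a a′ → a′ ≈ᴾ a → IsZChain Π a → IsZChain Π a′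
    IsZChain-resp a a′ a′≈a (infinite , inDomRan) =
      (λ N → let (w , inOrbit , distinct) = infinite N
             in w , (λ k → InOrbit-resp a a′ (w k) (w k) a′≈a (inOrbit k) (≈ᴾ-refl (w k))) , distinct) ,
      λ b a′~b → inDomRan b (InOrbit-resp a′ a b b (≈ᴾ-sym a′ a a′≈a) a′~b (≈ᴾ-refl b))

    -- Z-chains of the cohesive power

    module Family (infinite : InfiniteSet C) (n : ℕ) (long : HasLongPaths) where
      open PathSearch n long

      path-step : ∀ i k → k < len i → F (path i k) (path i (suc k))
      path-step i = proj₁ (path-Path i)

      pos+r<len : ∀ i {j r} → j < n → r ≤ i → pos j i + r < len i
      pos+r<len i = +-offset-fits {i}

      pos<len : ∀ i {j} → j < n → pos j i < len i
      pos<len i {j} j<n = subst (_< len i) (+-identityʳ (pos j i)) (pos+r<len i j<n z≤n)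

      fʳ∘ψ : ℕ → ℕ → PR 1
      fʳ∘ψ j zero    = ψ j
      fʳ∘ψ j (suc r) = f∘ (fʳ∘ψ j r)

      Eval-fʳ∘ψ : ∀ {j} → j < n → ∀ r i → r ≤ i → Eval (fʳ∘ψ j r) (i ∷ []) (path i (pos j i + r))
      Eval-fʳ∘ψ {j} j<n zero    i _ = subst (λ k → Eval (ψ j) (i ∷ []) (path i k)) (sym (+-identityʳ (pos j i))) (Eval-ψ j i)
      Eval-fʳ∘ψ {j} j<n (suc r) i r<i =
        subst (λ k → Eval (fʳ∘ψ j (suc r)) (i ∷ []) (path i k)) (sym (+-suc (pos j i) r))
          (f∘-converges (Eval-fʳ∘ψ j<n r i (≤-trans (n≤1+n r) r<i)) (path-step i _ (pos+r<len i j<n (≤-trans (n≤1+n r) r<i))))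

      fʳ∘ψ-into-A : ∀ {j} → j < n → ∀ r i v → Eval (fʳ∘ψ j r) (i ∷ []) v → InA v
      fʳ∘ψ-into-A {j} j<n zero i v ψ↦v =
        subst InA (Eval-deterministic (Eval-ψ j i) ψ↦v) (proj₂ (f-into _ _ (path-step i (j + i * suc j) (<⇒≤ (pos<len i j<n)))))
      fʳ∘ψ-into-A j<n (suc r) i v fψ↦v = proj₂ (f-into _ _ (proj₂ (proj₂ (Eval-f∘ fψ↦v))))

      ψᴾ : ∀ {j} → j < n → ℕ → Elt
      ψᴾ {j} j<n r = record
        { code   = fʳ∘ψ j r
        ; into-A = fʳ∘ψ-into-A j<n r
        ; dom-C  = ⊆*-cofinite r (λ i r≤i _ → _ , Eval-fʳ∘ψ j<n r i r≤i) }

      ψᴾ-Iter : ∀ {j} (j<n : j < n) s r → Iter Π s (ψᴾ j<n r) (ψᴾ j<n (r + s))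
      ψᴾ-Iter j<n zero    r = subst (λ k → ψᴾ j<n r ≈ᴾ ψᴾ j<n k) (sym (+-identityʳ r)) (≈ᴾ-refl (ψᴾ j<n r))
      ψᴾ-Iter j<n (suc s) r =
        ψᴾ j<n (suc r) , Gᴾ-fᴾ (ψᴾ j<n r) (PowElt.dom-C (ψᴾ j<n (suc r))) ,
        subst (λ k → Iter Π s (ψᴾ j<n (suc r)) (ψᴾ j<n k)) (sym (+-suc r s)) (ψᴾ-Iter j<n s (suc r))

      -- Beyond i ≥ max r r′ both are evaluated at distinct positions of one path.
      ψᴾ-injective : ∀ {j} (j<n : j < n) r r′ → ψᴾ j<n r ≈ᴾ ψᴾ j<n r′ → r ≡ r′
      ψᴾ-injective {j} j<n r r′ r≈r′ with r ≟ r′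
      ... | yes r≡r′ = r≡r′
      ... | no  r≢r′ = ⊥-elim (⊆*-refute infinite r≈r′ (r ⊔ r′) λ i r⊔r′≤i _ (v , r↦v , r′↦v) →
        let r≤i  = ≤-trans (m≤m⊔n r r′) r⊔r′≤i
            r′≤i = ≤-trans (m≤n⊔m r r′) r⊔r′≤i
        in r≢r′ (+-cancelˡ-≡ (pos j i) _ _ (Path-injective (path-Path i) _ _
             (<⇒≤ (pos+r<len i j<n r≤i)) (<⇒≤ (pos+r<len i j<n r′≤i))
             (trans (Eval-deterministic (Eval-fʳ∘ψ j<n r i r≤i) r↦v)
                    (Eval-deterministic r′↦v (Eval-fʳ∘ψ j<n r′ i r′≤i))))))

      Interior : Elt → Set
      Interior b = ∃ λ (q : ℕ → ℕ) → C ⊆* (λ i → b at i ↦ path i (q i)) ×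
                   ∃ λ N → ∀ i → N ≤ i → 1 ≤ q i × q i < len i

      Interior⇒InDom×InRan : ∀ b → Interior b → InDom Π b × InRan Π b
      Interior⇒InDom×InRan b (q , b↦path , N , inside) = (fᴾ b dom , Gᴾ-fᴾ b dom) , (f⁻¹ᴾ b dom⁻¹ , Gᴾ-f⁻¹ᴾ b dom⁻¹)
        where
        dom : C ⊆* (λ i → f∘ (PowElt.code b) ↓ i)
        dom = ⊆*-map b↦path N λ i N≤i _ b↦ → _ , f∘-converges b↦ (path-step i (q i) (proj₂ (inside i N≤i)))
        has-preimage : ∀ i k → 1 ≤ k → k < len i → b at i ↦ path i k → f⁻¹∘ (PowElt.code b) ↓ i
        has-preimage i (suc k) _ k<len b↦ = f⁻¹∘-converges b↦ (path-step i k (<⇒≤ k<len))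
        dom⁻¹ : C ⊆* (λ i → f⁻¹∘ (PowElt.code b) ↓ i)
        dom⁻¹ = ⊆*-map b↦path N λ i N≤i _ → has-preimage i (q i) (proj₁ (inside i N≤i)) (proj₂ (inside i N≤i))

      orbit⇒Interior : ∀ {j} (j<n : j < n) b → InOrbit Π (ψᴾ j<n 0) b → Interior b
      orbit⇒Interior {j} j<n b (m , inj₁ iter) =
        (λ i → pos j i + m) ,
        ⊆*-map (Iter⇒StepsOnC m _ _ iter) m (λ i m≤i _ (u , v , ψ↦u , b↦v , steps) →
          subst (b at i ↦_) (Steps-functional m (subst (λ z → Steps m z v) (Eval-deterministic ψ↦u (Eval-ψ j i)) steps)
                                                 (Path-Steps (path-Path i) m (pos j i) (<⇒≤ (pos+r<len i j<n m≤i)))) b↦v) ,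
        m , λ i m≤i → s≤s z≤n , pos+r<len i j<n m≤i
      orbit⇒Interior {j} j<n b (m , inj₂ iter) =
        (λ i → pos j i ∸ m) ,
        ⊆*-map (Iter⇒StepsOnC m _ _ iter) m (λ i m≤i _ (u , v , b↦u , ψ↦v , steps) →
          subst (b at i ↦_) (Steps-injective m (subst (Steps m u) (Eval-deterministic ψ↦v (Eval-ψ j i)) steps)
                                                (steps-to-pos i m≤i)) b↦u) ,
        m , λ i m≤i → m<n⇒0<n∸m (m<pos i m≤i) , ≤-<-trans (m∸n≤m (pos j i) m) (pos<len i j<n)
        where
        m<pos : ∀ i → m ≤ i → m < pos j i
        m<pos i m≤i = ≤-trans (s≤s m≤i) (m≤m*n (suc i) (suc j))
        steps-to-pos : ∀ i → m ≤ i → Steps m (path i (pos j i ∸ m)) (path i (pos j i))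
        steps-to-pos i m≤i = subst (λ k → Steps m (path i (pos j i ∸ m)) (path i k)) (m∸n+n≡m (<⇒≤ (m<pos i m≤i)))
          (Path-Steps (path-Path i) m (pos j i ∸ m)
            (subst (_≤ len i) (sym (m∸n+n≡m (<⇒≤ (m<pos i m≤i)))) (<⇒≤ (pos<len i j<n))))

      ψᴾ-IsZChain : ∀ {j} (j<n : j < n) → IsZChain Π (ψᴾ j<n 0)
      ψᴾ-IsZChain j<n =
        (λ N → (λ k → ψᴾ j<n (toℕ k)) , (λ k → toℕ k , inj₁ (ψᴾ-Iter j<n (toℕ k) 0)) ,
               λ k k′ k≈k′ → toℕ-injective (ψᴾ-injective j<n _ _ k≈k′)) ,
        λ b orbit → Interior⇒InDom×InRan b (orbit⇒Interior j<n b orbit)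

      -- Beyond i ≥ m, ψ_j + m and ψ_k are at positions (1+i)(1+j) + m ≠ (1+i)(1+k) of one path.
      ψᴾ-Iter⇒≡ : ∀ {j k} (j<n : j < n) (k<n : k < n) m → Iter Π m (ψᴾ j<n 0) (ψᴾ k<n 0) → j ≡ k
      ψᴾ-Iter⇒≡ {j} {k} j<n k<n m iter with j ≟ k
      ... | yes j≡k = j≡k
      ... | no  j≢k = ⊥-elim (⊆*-refute infinite (Iter⇒StepsOnC m _ _ iter) m λ i m≤i _ (u , v , ψj↦u , ψk↦v , steps) →
        j≢k (+-offset-injective m≤i (Path-injective (path-Path i) _ _
          (<⇒≤ (pos+r<len i j<n m≤i)) (<⇒≤ (pos<len i k<n))
          (Steps-functional m (Path-Steps (path-Path i) m (pos j i) (<⇒≤ (pos+r<len i j<n m≤i)))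
            (subst₂ (Steps m) (Eval-deterministic ψj↦u (Eval-ψ j i)) (Eval-deterministic ψk↦v (Eval-ψ k i)) steps)))))

      ψᴾ-orbits-distinct : ∀ {j k} (j<n : j < n) (k<n : k < n) → InOrbit Π (ψᴾ j<n 0) (ψᴾ k<n 0) → j ≡ k
      ψᴾ-orbits-distinct j<n k<n (m , inj₁ iter) = ψᴾ-Iter⇒≡ j<n k<n m iter
      ψᴾ-orbits-distinct j<n k<n (m , inj₂ iter) = sym (ψᴾ-Iter⇒≡ k<n j<n m iter)

    infinitelyManyZChains : InfiniteSet C → HasLongPaths → InfinitelyManyZChains Π
    infinitelyManyZChains infinite long n =
      (λ k → ψᴾ (toℕ<n k) 0) , (λ k → ψᴾ-IsZChain (toℕ<n k)) ,
      λ k k′ orbit → toℕ-injective (ψᴾ-orbits-distinct (toℕ<n k) (toℕ<n k′) orbit)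
      where open Family infinite n long

    module _ (iso : 𝑆 ≅ Π) where
      open _≅_ iso

      ≅-Iter : ∀ m {x y} → Iter 𝑆 m x y → Iter Π m (h x) (h y)
      ≅-Iter zero    {x} {y} x≈y         = resp x y x≈y
      ≅-Iter (suc m) {x} (c , Gxc , iter) = h c , pres x c Gxc , ≅-Iter m iter

      ≅-InOrbit : ∀ {x y} → InOrbit 𝑆 x y → InOrbit Π (h x) (h y)
      ≅-InOrbit (m , inj₁ iter) = m , inj₁ (≅-Iter m iter)
      ≅-InOrbit (m , inj₂ iter) = m , inj₂ (≅-Iter m iter)

      ≅⁻¹-Iter-from : ∀ m x z → Iter Π m (h x) z → ∃ λ y → Iter 𝑆 m x y × h y ≈ᴾ z
      ≅⁻¹-Iter-from zero    x z hx≈z            = x , refl , hx≈z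
      ≅⁻¹-Iter-from (suc m) x z (c , Ghxc , iter) with surj c
      ... | y′ , hy′≈c with ≅⁻¹-Iter-from m y′ z (Iter-resp m c (h y′) z z hy′≈c iter (≈ᴾ-refl z))
      ... | y , y′→y , hy≈z =
        y , (y′ , refl-G x y′ (Gᴾ-resp (h x) (h x) c (h y′) (≈ᴾ-refl (h x)) Ghxc (≈ᴾ-sym (h y′) c hy′≈c)) , y′→y) , hy≈z

      ≅⁻¹-Iter-to : ∀ m x z → Iter Π m z (h x) → ∃ λ y → Iter 𝑆 m y x × h y ≈ᴾ z
      ≅⁻¹-Iter-to zero    x z z≈hx            = x , refl , ≈ᴾ-sym z (h x) z≈hx
      ≅⁻¹-Iter-to (suc m) x z (c , Gzc , iter) with ≅⁻¹-Iter-to m x c iter | surj z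
      ... | y′ , y′→x , hy′≈c | y , hy≈z =
        y , (y′ , refl-G y y′ (Gᴾ-resp z (h y) c (h y′) hy≈z Gzc (≈ᴾ-sym (h y′) c hy′≈c)) , y′→x) , hy≈z

      ≅⁻¹-InOrbit : ∀ x z → InOrbit Π (h x) z → ∃ λ y → InOrbit 𝑆 x y × h y ≈ᴾ z
      ≅⁻¹-InOrbit x z (m , inj₁ iter) = let (y , x→y , hy≈z) = ≅⁻¹-Iter-from m x z iter in y , (m , inj₁ x→y) , hy≈z
      ≅⁻¹-InOrbit x z (m , inj₂ iter) = let (y , y→x , hy≈z) = ≅⁻¹-Iter-to m x z iter in y , (m , inj₂ y→x) , hy≈z

      ≅⁻¹-IsZChain : ∀ x → IsZChain Π (h x) → IsZChain 𝑆 x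
      ≅⁻¹-IsZChain x (infinite , inDomRan) = infinite′ , inDomRan′
        where
        infinite′ : InfiniteOrbit 𝑆 x
        infinite′ N = y , (λ k → proj₁ (proj₂ (pulled k))) , λ k l yk≡yl →
            distinct k l (≈ᴾ-trans (w k) (h (y k)) (w l) (≈ᴾ-sym (h (y k)) (w k) (proj₂ (proj₂ (pulled k))))
                           (≈ᴾ-trans (h (y k)) (h (y l)) (w l) (resp _ _ yk≡yl) (proj₂ (proj₂ (pulled l)))))
          where
          w : Fin N → Elt
          w = proj₁ (infinite N)
          distinct : ∀ k l → w k ≈ᴾ w l → k ≡ l
          distinct = proj₂ (proj₂ (infinite N))
          pulled : ∀ k → ∃ λ y → InOrbit 𝑆 x y × h y ≈ᴾ w k
          pulled k = ≅⁻¹-InOrbit x (w k) (proj₁ (proj₂ (infinite N)) k)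
          y : Fin N → Str.Carrier 𝑆
          y k = proj₁ (pulled k)
        inDomRan′ : ∀ b → InOrbit 𝑆 x b → InDom 𝑆 b × InRan 𝑆 b
        inDomRan′ b x~b with inDomRan (h b) (≅-InOrbit x~b)
        ... | (c , Ghbc) , (c′ , Gc′hb) with surj c | surj c′
        ... | y , hy≈c | y′ , hy′≈c′ =
          (y  , refl-G b y (Gᴾ-resp (h b) (h b) c (h y) (≈ᴾ-refl (h b)) Ghbc (≈ᴾ-sym (h y) c hy≈c))) ,
          (y′ , refl-G y′ b (Gᴾ-resp c′ (h y′) (h b) (h b) hy′≈c′ Gc′hb (≈ᴾ-refl (h b))))

    -- Pulled back along an isomorphism, 1+n distinct Z-chains of Π would give 1+n Z-chains of 𝒜
    -- in distinct orbits, but 𝒜's Z-chains lie in only n orbits.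
    ≇-by-ZChain-count : InfinitelyManyZChains Π → FinitelyManyZChains 𝑆 → ¬ (𝑆 ≅ Π)
    ≇-by-ZChain-count many (n , v , covered) iso with many (suc n)
    ... | z , isZChain , distinct =
      let (i , j , i<j , same) = pigeonhole ≤-refl σ
          xᵢ~xⱼ = InOrbit-common (subst (λ k → InOrbit 𝑆 (v k) (x i)) same (proj₂ (cover i))) (proj₂ (cover j))
      in <-irrefl (cong toℕ (distinct i j (InOrbit-resp (h (x i)) (z i) (h (x j)) (z j)
           (≈ᴾ-sym (h (x i)) (z i) (hx≈z i)) (≅-InOrbit iso xᵢ~xⱼ) (hx≈z j)))) i<j
      where
      open _≅_ iso
      x : Fin (suc n) → Str.Carrier 𝑆
      x k = proj₁ (surj (z k))
      hx≈z : ∀ k → h (x k) ≈ᴾ z k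
      hx≈z k = proj₂ (surj (z k))
      cover : ∀ k → ∃ λ i → InOrbit 𝑆 (v i) (x k)
      cover k = covered (x k) (≅⁻¹-IsZChain iso (x k) (IsZChain-resp (z k) (h (x k)) (hx≈z k) (isZChain k)))
      σ : Fin (suc n) → Fin n
      σ k = proj₁ (cover k)

mainTheorem18 : (𝒜 : CompPIS) (C : ℕ → Set) →
    (UnboundedCycleCharacter (structure 𝒜)
      ⊎ UnboundedFiniteChainCharacter (structure 𝒜)
      ⊎ HasInfiniteOrbit (structure 𝒜)) →
    Cohesive C →
    InfinitelyManyZChains (CohesivePower 𝒜 C)
      × (FinitelyManyZChains (structure 𝒜) → ¬ (structure 𝒜 ≅ CohesivePower 𝒜 C))
mainTheorem18 𝒜 C hypothesis (infinite , _) = many , ≇-by-ZChain-count 𝒜 C many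
  where
  long : HasLongPaths 𝒜
  long = [ cycles-paths 𝒜 , [ chains-paths 𝒜 , infinite-orbit-paths 𝒜 ]′ ]′ hypothesis
  many : InfinitelyManyZChains (CohesivePower 𝒜 C)
  many = infinitelyManyZChains 𝒜 C infinite long
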